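{- Let $A=2^\omega$ (the set of subsets of $\omega$) partially ordered by inclusion, let $U(A)\subseteq 2^A$ be its set of up-sets with the topology induced by the natural topology on $2^A$, and for each $n\in\omega$ let $e_n\in U(A)$ be the set of subsets of $\omega$ containing $n$. For $x\in U(A)$ the following are equivalent: (i) $x$ is an isolated point of $U(A)$; (ii) $x$ is both the union of a finite (possibly empty) family of principal up-sets and the intersection of a finite (possibly empty) family of complements of principal down-sets of $A$; (iii) $x$ lies in the closure of $\{e_n\mid n\in\omega\}\cup\{\emptyset,A\}$ under pairwise unions and intersections.
   Context: For $a\in A$, ${\uparrow}(a)=\{b\mid b\supseteq a\}$ is the principal up-set and ${\downarrow}(a)=\{b\mid b\subseteq a\}$ the principal down-set. The natural topology on $2^A$ is the product topology of discrete copies of $\{0,1\}$, with subbasis the sets $\{x\mid a\in x\}$ and $\{x\mid a\notin x\}$ for $a\in A$. The empty union is $\emptyset$ and the empty intersection is $A$. -}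

module Defs where

open import Level using (0ℓ)
open import Data.Nat using (ℕ)
open import Data.Bool using (Bool; true)
open import Data.List using (List; map; []; _∷_)
open import Data.List.Relation.Unary.All using (All)
open import Data.Product using (Σ; ∃; _×_)
open import Data.Sum using (_⊎_)
open import Data.Empty using (⊥)
open import Data.Unit using (⊤)
open import Relation.Nullary using (¬_)
open import Relation.Binary.PropositionalEquality using (_≡_)

-- A = 2^ω : subsets of ω, as characteristic functions
𝒜 : Set
𝒜 = ℕ → Bool

_⊆ᴬ_ : 𝒜 → 𝒜 → Set
a ⊆ᴬ b = ∀ n → a n ≡ true → b n ≡ true

Sub : Set₁
Sub = 𝒜 → Set

_≐_ : Sub → Sub → Set
x ≐ y = ∀ a → (x a → y a) × (y a → x a)

IsUpSet : Sub → Set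
IsUpSet x = ∀ a b → a ⊆ᴬ b → x a → x b

↑ : 𝒜 → Sub
↑ a = λ b → a ⊆ᴬ b

↓ : 𝒜 → Sub
↓ a = λ b → b ⊆ᴬ a

∁ : Sub → Sub
∁ x = λ a → ¬ x a

⋃ : List Sub → Sub
⋃ [] = λ _ → ⊥
⋃ (s ∷ ss) = λ a → s a ⊎ ⋃ ss a

⋂ : List Sub → Sub
⋂ [] = λ _ → ⊤
⋂ (s ∷ ss) = λ a → s a × ⋂ ss a

e : ℕ → Sub
e n = λ a → a n ≡ true

-- (i) x is an isolated point of U(A) with the topology induced from the product
-- topology on 2^A: some basic open set { y | a ∈ y for a ∈ pos, b ∉ y for b ∈ neg }
-- contains x and meets U(A) only in x.
IsIsolated : Sub → Set₁
IsIsolated x = Σ (List 𝒜) λ pos → Σ (List 𝒜) λ neg →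
  All x pos × All (∁ x) neg ×
  (∀ y → IsUpSet y → All y pos → All (∁ y) neg → y ≐ x)

IsFinUpDown : Sub → Set
IsFinUpDown x =
  (∃ λ (as : List 𝒜) → x ≐ ⋃ (map ↑ as)) ×
  (∃ λ (bs : List 𝒜) → x ≐ ⋂ (map (λ b → ∁ (↓ b)) bs))

-- (iii) the closure of {e_n} ∪ {∅, A} under pairwise ∪ and ∩ : elements are the
-- denotations of lattice terms
data LTerm : Set where
  gen   : ℕ → LTerm
  bot   : LTerm
  top   : LTerm
  _∪ₜ_  : LTerm → LTerm → LTerm
  _∩ₜ_  : LTerm → LTerm → LTerm

⟦_⟧ : LTerm → Sub
⟦ gen n ⟧ = e n
⟦ bot ⟧ = λ _ → ⊥
⟦ top ⟧ = λ _ → ⊤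
⟦ s ∪ₜ t ⟧ = λ a → ⟦ s ⟧ a ⊎ ⟦ t ⟧ a
⟦ s ∩ₜ t ⟧ = λ a → ⟦ s ⟧ a × ⟦ t ⟧ a

InLatticeClosure : Sub → Set
InLatticeClosure x = ∃ λ (t : LTerm) → x ≐ ⟦ t ⟧

-- For an up-set y, the basic neighbourhood given by pos and neg contains y iff
-- ↑pos ⊆ y ⊆ A ∖ ↓neg, where ↑pos and ↓neg are the up- and down-sets generated by the
-- finite lists; both bounds are up-sets in the neighbourhood, so x is isolated exactly
-- when both equal x, which is (ii).  Sets of the form ↑as, as well as sets of the form
-- A ∖ ↓bs, are closed under ∪ and ∩ (↑a ∩ ↑b = ↑(a ∪ b), ↓a ∩ ↓b = ↓(a ∩ b), and De Morgan)
-- and contain e_n = ↑{n} = A ∖ ↓(ω ∖ {n}), ∅ and A: this is (iii) ⇒ (ii).  Conversely,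
-- if ↑as ⊆ A ∖ ↓bs then each a ∈ as and b ∈ bs are separated by some n ∈ a ∖ b, so
-- ↑a ⊆ e_n ⊆ A ∖ ↓b, and the lattice term ⋃_a ⋂_b e_n lies between ↑as and A ∖ ↓bs.
module Submission where

open import Defs
open import Level using (0ℓ) renaming (suc to lsuc)
open import Function using (_∘_; const)
open import Function.Bundles using (_⇔_; mk⇔; Equivalence)
open import Axiom.ExcludedMiddle using (ExcludedMiddle)
open import Data.Nat using (ℕ; _≡ᵇ_)
open import Data.Nat.Properties using (≡⇒≡ᵇ; ≡ᵇ⇒≡)
open import Data.Bool using (true; false; not; _∧_; _∨_)
open import Data.Bool.Properties using (∨-zeroʳ; T-≡) renaming (_≟_ to _≟ᴮ_)
open import Data.List using (List; []; _∷_; map; _++_; cartesianProductWith)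
open import Data.List.Relation.Unary.Any as Any using (Any; here; there)
open import Data.List.Relation.Unary.Any.Properties as Anyₚ using ()
open import Data.List.Relation.Unary.All as All using (All; []; _∷_)
open import Data.List.Relation.Unary.All.Properties using (¬Any⇒All¬)
open import Data.Product as Prod using (_×_; _,_; proj₁; proj₂; ∃; uncurry)
open import Data.Sum as Sum using (_⊎_; inj₁; inj₂; [_,_])
open import Data.Unit using (tt)
open import Relation.Nullary using (¬_; yes; no; contradiction)
open import Relation.Unary using (_⊆_; _∪_; _∩_; ∅)
open import Relation.Binary.Bundles using (Setoid)
open import Relation.Binary.PropositionalEquality using (_≡_; refl; cong; trans; sym)

private variable
  a b c : 𝒜
  as bs : List 𝒜
  x y z w x′ y′ : Sub
  F : 𝒜 → Sub
  n : ℕ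

EM : Set₁
EM = ExcludedMiddle 0ℓ

≐⇒⊆ : x ≐ y → x ⊆ y
≐⇒⊆ p = proj₁ (p _)

≐⇒⊇ : x ≐ y → y ⊆ x
≐⇒⊇ p = proj₂ (p _)

⊆-antisym : x ⊆ y → y ⊆ x → x ≐ y
⊆-antisym p q _ = p , q

≐-refl : x ≐ x
≐-refl = ⊆-antisym (λ h → h) (λ h → h)

≐-sym : x ≐ y → y ≐ x
≐-sym p = ⊆-antisym (≐⇒⊇ p) (≐⇒⊆ p)

≐-trans : x ≐ y → y ≐ z → x ≐ z
≐-trans p q = ⊆-antisym (≐⇒⊆ q ∘ ≐⇒⊆ p) (≐⇒⊇ p ∘ ≐⇒⊇ q)

≐-setoid : Setoid (lsuc 0ℓ) 0ℓ
≐-setoid = record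
  { Carrier = Sub
  ; _≈_ = _≐_
  ; isEquivalence = record { refl = ≐-refl ; sym = ≐-sym ; trans = ≐-trans }
  }

open import Relation.Binary.Reasoning.Setoid ≐-setoid

≐-squeeze : x ≐ y → x ≐ z → y ⊆ w → w ⊆ z → x ≐ w
≐-squeeze p q y⊆w w⊆z = ⊆-antisym (y⊆w ∘ ≐⇒⊆ p) (≐⇒⊇ q ∘ w⊆z)

∪-cong : x ≐ x′ → y ≐ y′ → (x ∪ y) ≐ (x′ ∪ y′)
∪-cong p q = ⊆-antisym (Sum.map (≐⇒⊆ p) (≐⇒⊆ q)) (Sum.map (≐⇒⊇ p) (≐⇒⊇ q))

∩-cong : x ≐ x′ → y ≐ y′ → (x ∩ y) ≐ (x′ ∩ y′)
∩-cong p q = ⊆-antisym (Prod.map (≐⇒⊆ p) (≐⇒⊆ q)) (Prod.map (≐⇒⊇ p) (≐⇒⊇ q))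

∁-cong : x ≐ y → ∁ x ≐ ∁ y
∁-cong p = ⊆-antisym (λ h → h ∘ ≐⇒⊇ p) (λ h → h ∘ ≐⇒⊆ p)

∁-∪ : ∁ (x ∪ y) ≐ (∁ x ∩ ∁ y)
∁-∪ = ⊆-antisym (λ h → h ∘ inj₁ , h ∘ inj₂) (λ (h , k) → [ h , k ])

∁-∩ : EM → ∁ (x ∩ y) ≐ (∁ x ∪ ∁ y)
∁-∩ {x} {y} em = ⊆-antisym split (λ { (inj₁ h) → h ∘ proj₁ ; (inj₂ h) → h ∘ proj₂ })
  where
  split : ∁ (x ∩ y) ⊆ (∁ x ∪ ∁ y)
  split {c} h with em {x c}
  ... | yes xc = inj₂ (λ yc → h (xc , yc))
  ... | no ¬xc = inj₁ ¬xc

⋃ᶠ : (𝒜 → Sub) → List 𝒜 → Sub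
⋃ᶠ F as c = Any (λ a → F a c) as

⋃ᶠ-[] : ⋃ᶠ F [] ≐ ∅
⋃ᶠ-[] = ⊆-antisym (λ ()) (λ ())

⋃ᶠ-∷ : ⋃ᶠ F (a ∷ as) ≐ (F a ∪ ⋃ᶠ F as)
⋃ᶠ-∷ = ⊆-antisym Any.toSum Any.fromSum

⋃ᶠ-[_] : ∀ a → ⋃ᶠ F (a ∷ []) ≐ F a
⋃ᶠ-[ a ] = ⊆-antisym (λ { (here h) → h ; (there ()) }) here

⋃ᶠ-++ : ⋃ᶠ F (as ++ bs) ≐ (⋃ᶠ F as ∪ ⋃ᶠ F bs)
⋃ᶠ-++ {as = as} = ⊆-antisym (Anyₚ.++⁻ as) [ Anyₚ.++⁺ˡ , Anyₚ.++⁺ʳ as ]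

⋃ᶠ-cartesianProductWith : {g : 𝒜 → 𝒜 → 𝒜} → (∀ {a b} → F (g a b) ≐ (F a ∩ F b)) →
  ⋃ᶠ F (cartesianProductWith g as bs) ≐ (⋃ᶠ F as ∩ ⋃ᶠ F bs)
⋃ᶠ-cartesianProductWith {as = as} {bs = bs} {g = g} F-g = ⊆-antisym
  (Anyₚ.cartesianProductWith⁻ g (≐⇒⊆ F-g) as bs)
  (λ (p , q) → Anyₚ.cartesianProductWith⁺ g (λ Fa Fb → ≐⇒⊇ F-g (Fa , Fb)) p q)

⋃ᶠ-contains : (∀ {a} → F a a) → All (⋃ᶠ F as) as
⋃ᶠ-contains {as = []} F-refl = []
⋃ᶠ-contains {as = a ∷ as} F-refl = here F-refl ∷ All.map there (⋃ᶠ-contains F-refl)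

⋃-map : ⋃ (map F as) ≐ ⋃ᶠ F as
⋃-map {as = []} = ≐-sym ⋃ᶠ-[]
⋃-map {as = a ∷ as} = ≐-trans (∪-cong ≐-refl ⋃-map) (≐-sym ⋃ᶠ-∷)

⋂-map-∁ : ⋂ (map (λ a → ∁ (F a)) as) ≐ ∁ (⋃ᶠ F as)
⋂-map-∁ {as = []} = ⊆-antisym (λ _ ()) (λ _ → tt)
⋂-map-∁ {F = F} {as = a ∷ as} = begin
  (∁ (F a) ∩ ⋂ (map (λ a → ∁ (F a)) as)) ≈⟨ ∩-cong ≐-refl ⋂-map-∁ ⟩
  (∁ (F a) ∩ ∁ (⋃ᶠ F as))                 ≈⟨ ∁-∪ ⟨
  ∁ (F a ∪ ⋃ᶠ F as)                       ≈⟨ ∁-cong ⋃ᶠ-∷ ⟨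
  ∁ (⋃ᶠ F (a ∷ as))                       ∎

⊆ᴬ-refl : a ⊆ᴬ a
⊆ᴬ-refl _ h = h

⊆ᴬ-trans : a ⊆ᴬ b → b ⊆ᴬ c → a ⊆ᴬ c
⊆ᴬ-trans p q n = q n ∘ p n

_∪ᴬ_ _∩ᴬ_ : 𝒜 → 𝒜 → 𝒜
(a ∪ᴬ b) n = a n ∨ b n
(a ∩ᴬ b) n = a n ∧ b n

∨-true⁻ : ∀ p {q} → p ∨ q ≡ true → p ≡ true ⊎ q ≡ true
∨-true⁻ true  _ = inj₁ refl
∨-true⁻ false h = inj₂ h

∧-true⁻ : ∀ p {q} → p ∧ q ≡ true → p ≡ true × q ≡ true
∧-true⁻ true h = refl , h

∧-true⁺ : ∀ {p q} → p ≡ true → q ≡ true → p ∧ q ≡ true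
∧-true⁺ refl refl = refl

↑-∪ᴬ : ↑ (a ∪ᴬ b) ≐ (↑ a ∩ ↑ b)
↑-∪ᴬ {a} {b} = ⊆-antisym
  (λ h → (λ n an → h n (cong (_∨ b n) an)) , (λ n bn → h n (trans (cong (a n ∨_) bn) (∨-zeroʳ (a n)))))
  (λ (ha , hb) n abn → [ ha n , hb n ] (∨-true⁻ (a n) abn))

↓-∩ᴬ : ↓ (a ∩ᴬ b) ≐ (↓ a ∩ ↓ b)
↓-∩ᴬ {a} {b} = ⊆-antisym
  (λ h → (λ n cn → proj₁ (∧-true⁻ (a n) (h n cn))) , (λ n cn → proj₂ (∧-true⁻ (a n) (h n cn))))
  (λ (ha , hb) n cn → ∧-true⁺ (ha n cn) (hb n cn))

｛_｝ ω∖｛_｝ : ℕ → 𝒜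
｛ n ｝ m = n ≡ᵇ m
ω∖｛ n ｝ m = not (n ≡ᵇ m)

⊥ᴬ ⊤ᴬ : 𝒜
⊥ᴬ = const false
⊤ᴬ = const true

｛｝-self : ∀ n → ｛ n ｝ n ≡ true
｛｝-self n = Equivalence.to T-≡ (≡⇒≡ᵇ n n refl)

｛｝-true⇒≡ : ∀ n m → ｛ n ｝ m ≡ true → n ≡ m
｛｝-true⇒≡ n m = ≡ᵇ⇒≡ n m ∘ Equivalence.from T-≡

｛｝⊆ᴬ : c n ≡ true → ｛ n ｝ ⊆ᴬ c
｛｝⊆ᴬ {n = n} cn m n∈｛m｝ with refl ← ｛｝-true⇒≡ n m n∈｛m｝ = cn

⊆ᴬω∖｛｝ : c n ≡ false → c ⊆ᴬ ω∖｛ n ｝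
⊆ᴬω∖｛｝ {n = n} cn m cm with ｛ n ｝ m in n∈｛m｝
... | false = refl
... | true with refl ← ｛｝-true⇒≡ n m n∈｛m｝ = contradiction (trans (sym cm) cn) λ ()

e≐↑｛｝ : ∀ n → e n ≐ ↑ ｛ n ｝
e≐↑｛｝ n = ⊆-antisym ｛｝⊆ᴬ (λ h → h n (｛｝-self n))

e≐∁↓ω∖｛｝ : ∀ n → e n ≐ ∁ (↓ ω∖｛ n ｝)
e≐∁↓ω∖｛｝ n = ⊆-antisym
  (λ cn c⊆ω∖n → contradiction (trans (sym (c⊆ω∖n n cn)) (cong not (｛｝-self n))) λ ())
  ∁↓⇒e
  where
  ∁↓⇒e : ∁ (↓ ω∖｛ n ｝) ⊆ e n
  ∁↓⇒e {c} h with c n in cn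
  ... | true  = refl
  ... | false = contradiction (⊆ᴬω∖｛｝ cn) h

IsFinGenUp IsCoFinGenDown : Sub → Set
IsFinGenUp x = ∃ λ as → x ≐ ⋃ᶠ ↑ as
IsCoFinGenDown x = ∃ λ bs → x ≐ ∁ (⋃ᶠ ↓ bs)

isFinUpDown⇔ : IsFinUpDown x ⇔ (IsFinGenUp x × IsCoFinGenDown x)
isFinUpDown⇔ = mk⇔
  (Prod.map (Prod.map₂ (λ p → ≐-trans p ⋃-map))         (Prod.map₂ (λ p → ≐-trans p ⋂-map-∁)))
  (Prod.map (Prod.map₂ (λ p → ≐-trans p (≐-sym ⋃-map))) (Prod.map₂ (λ p → ≐-trans p (≐-sym ⋂-map-∁))))

isFinGenUp-∪ : IsFinGenUp x → IsFinGenUp y → IsFinGenUp (x ∪ y)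
isFinGenUp-∪ (as , p) (as′ , q) = as ++ as′ , ≐-trans (∪-cong p q) (≐-sym ⋃ᶠ-++)

isFinGenUp-∩ : IsFinGenUp x → IsFinGenUp y → IsFinGenUp (x ∩ y)
isFinGenUp-∩ (as , p) (as′ , q) =
  cartesianProductWith _∪ᴬ_ as as′ , ≐-trans (∩-cong p q) (≐-sym (⋃ᶠ-cartesianProductWith ↑-∪ᴬ))

isCoFinGenDown-∩ : IsCoFinGenDown x → IsCoFinGenDown y → IsCoFinGenDown (x ∩ y)
isCoFinGenDown-∩ {x} {y} (bs , p) (bs′ , q) = bs ++ bs′ , (begin
  (x ∩ y)                             ≈⟨ ∩-cong p q ⟩
  (∁ (⋃ᶠ ↓ bs) ∩ ∁ (⋃ᶠ ↓ bs′))        ≈⟨ ∁-∪ ⟨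
  ∁ (⋃ᶠ ↓ bs ∪ ⋃ᶠ ↓ bs′)              ≈⟨ ∁-cong ⋃ᶠ-++ ⟨
  ∁ (⋃ᶠ ↓ (bs ++ bs′))                ∎)

isCoFinGenDown-∪ : EM → IsCoFinGenDown x → IsCoFinGenDown y → IsCoFinGenDown (x ∪ y)
isCoFinGenDown-∪ {x} {y} em (bs , p) (bs′ , q) = cartesianProductWith _∩ᴬ_ bs bs′ , (begin
  (x ∪ y)                                          ≈⟨ ∪-cong p q ⟩
  (∁ (⋃ᶠ ↓ bs) ∪ ∁ (⋃ᶠ ↓ bs′))                     ≈⟨ ∁-∩ em ⟨
  ∁ (⋃ᶠ ↓ bs ∩ ⋃ᶠ ↓ bs′)                           ≈⟨ ∁-cong (⋃ᶠ-cartesianProductWith ↓-∩ᴬ) ⟨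
  ∁ (⋃ᶠ ↓ (cartesianProductWith _∩ᴬ_ bs bs′))      ∎)

⟦⟧-isFinGenUp : ∀ t → IsFinGenUp ⟦ t ⟧
⟦⟧-isFinGenUp (gen n) = ｛ n ｝ ∷ [] , ≐-trans (e≐↑｛｝ n) (≐-sym ⋃ᶠ-[ ｛ n ｝ ])
⟦⟧-isFinGenUp bot     = [] , ≐-sym ⋃ᶠ-[]
⟦⟧-isFinGenUp top     = ⊥ᴬ ∷ [] , ⊆-antisym (λ _ → here λ _ ()) (λ _ → tt)
⟦⟧-isFinGenUp (s ∪ₜ t) = isFinGenUp-∪ (⟦⟧-isFinGenUp s) (⟦⟧-isFinGenUp t)
⟦⟧-isFinGenUp (s ∩ₜ t) = isFinGenUp-∩ (⟦⟧-isFinGenUp s) (⟦⟧-isFinGenUp t)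

⟦⟧-isCoFinGenDown : EM → ∀ t → IsCoFinGenDown ⟦ t ⟧
⟦⟧-isCoFinGenDown em (gen n) =
  ω∖｛ n ｝ ∷ [] , ≐-trans (e≐∁↓ω∖｛｝ n) (∁-cong (≐-sym ⋃ᶠ-[ ω∖｛ n ｝ ]))
⟦⟧-isCoFinGenDown em bot     = ⊤ᴬ ∷ [] , ⊆-antisym (λ ()) (λ h → h (here λ _ _ → refl))
⟦⟧-isCoFinGenDown em top     = [] , ⊆-antisym (λ _ ()) (λ _ → tt)
⟦⟧-isCoFinGenDown em (s ∪ₜ t) = isCoFinGenDown-∪ em (⟦⟧-isCoFinGenDown em s) (⟦⟧-isCoFinGenDown em t)
⟦⟧-isCoFinGenDown em (s ∩ₜ t) = isCoFinGenDown-∩ (⟦⟧-isCoFinGenDown em s) (⟦⟧-isCoFinGenDown em t)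

latticeClosure⇒finGen : EM → InLatticeClosure x → IsFinGenUp x × IsCoFinGenDown x
latticeClosure⇒finGen em (t , x≐t) =
  Prod.map₂ (≐-trans x≐t) (⟦⟧-isFinGenUp t) , Prod.map₂ (≐-trans x≐t) (⟦⟧-isCoFinGenDown em t)

HasInterpolant : Sub → Sub → Set
HasInterpolant x y = ∃ λ t → x ⊆ ⟦ t ⟧ × ⟦ t ⟧ ⊆ y

∃-separating-point : EM → ¬ a ⊆ᴬ b → ∃ λ n → e n a × ¬ e n b
∃-separating-point {a} {b} em a⊈b with em {∃ λ n → e n a × ¬ e n b}
... | yes separated = separated
... | no ¬separated = contradiction a⊆b a⊈b
  where
  a⊆b : a ⊆ᴬ b
  a⊆b n an with b n ≟ᴮ true
  ... | yes bn = bn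
  ... | no ¬bn = contradiction (n , an , ¬bn) ¬separated

hasInterpolant-principal : EM → ¬ a ⊆ᴬ b → HasInterpolant (↑ a) (∁ (↓ b))
hasInterpolant-principal em a⊈b with n , an , ¬bn ← ∃-separating-point em a⊈b =
  gen n , (λ a⊆c → a⊆c n an) , (λ cn c⊆b → ¬bn (c⊆b n cn))

hasInterpolant-⋃ᶠ : All (λ a → HasInterpolant (F a) z) as → HasInterpolant (⋃ᶠ F as) z
hasInterpolant-⋃ᶠ [] = bot , (λ ()) , (λ ())
hasInterpolant-⋃ᶠ ((t , ⊆t , t⊆) ∷ rest) with t′ , ⊆t′ , t′⊆ ← hasInterpolant-⋃ᶠ rest =
  t ∪ₜ t′ , Sum.map ⊆t ⊆t′ ∘ Any.toSum , [ t⊆ , t′⊆ ]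

hasInterpolant-∁⋃ᶠ : All (λ b → HasInterpolant y (∁ (F b))) bs → HasInterpolant y (∁ (⋃ᶠ F bs))
hasInterpolant-∁⋃ᶠ [] = top , (λ _ → tt) , (λ _ ())
hasInterpolant-∁⋃ᶠ ((t , ⊆t , t⊆) ∷ rest) with t′ , ⊆t′ , t′⊆ ← hasInterpolant-∁⋃ᶠ rest =
  t ∩ₜ t′ , (λ h → ⊆t h , ⊆t′ h) , (λ (h , h′) → [ t⊆ h , t′⊆ h′ ] ∘ Any.toSum)

hasInterpolant-⋃ᶠ↑-∁⋃ᶠ↓ : EM → ⋃ᶠ ↑ as ⊆ ∁ (⋃ᶠ ↓ bs) → HasInterpolant (⋃ᶠ ↑ as) (∁ (⋃ᶠ ↓ bs))
hasInterpolant-⋃ᶠ↑-∁⋃ᶠ↓ {bs = bs} em ⋃↑⊆∁⋃↓ = hasInterpolant-⋃ᶠ (All.map separate (⋃ᶠ-contains ⊆ᴬ-refl))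
  where
  separate : ⋃ᶠ ↑ _ a → HasInterpolant (↑ a) (∁ (⋃ᶠ ↓ bs))
  separate a∈ = hasInterpolant-∁⋃ᶠ (All.map (hasInterpolant-principal em) (¬Any⇒All¬ bs (⋃↑⊆∁⋃↓ a∈)))

finGen⇒latticeClosure : EM → IsFinGenUp x → IsCoFinGenDown x → InLatticeClosure x
finGen⇒latticeClosure em (as , x≐⋃↑) (bs , x≐∁⋃↓)
  with t , ⊆t , t⊆ ← hasInterpolant-⋃ᶠ↑-∁⋃ᶠ↓ em (≐⇒⊆ x≐∁⋃↓ ∘ ≐⇒⊇ x≐⋃↑) =
  t , ≐-squeeze x≐⋃↑ x≐∁⋃↓ ⊆t t⊆

⋃ᶠ↑-isUpSet : IsUpSet (⋃ᶠ ↑ as)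
⋃ᶠ↑-isUpSet _ _ b⊆c = Any.map (λ a⊆b → ⊆ᴬ-trans a⊆b b⊆c)

∁⋃ᶠ↓-isUpSet : IsUpSet (∁ (⋃ᶠ ↓ bs))
∁⋃ᶠ↓-isUpSet _ _ b⊆c b∉ c∈ = b∉ (Any.map (⊆ᴬ-trans b⊆c) c∈)

⋃ᶠ↑-least : IsUpSet y → All y as → ⋃ᶠ ↑ as ⊆ y
⋃ᶠ↑-least up ys c∈ with ya , a⊆c ← All.lookupAny ys c∈ = up _ _ a⊆c ya

∁⋃ᶠ↓-greatest : IsUpSet y → All (∁ y) bs → y ⊆ ∁ (⋃ᶠ ↓ bs)
∁⋃ᶠ↓-greatest up ∌ys yc c∈ with ¬yb , c⊆b ← All.lookupAny ∌ys c∈ = ¬yb (up _ _ c⊆b yc)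

isolated⇒finGen : IsUpSet x → IsIsolated x → IsFinGenUp x × IsCoFinGenDown x
isolated⇒finGen up (pos , neg , x∋pos , x∌neg , isolated) =
  (pos , ≐-sym (isolated _ ⋃ᶠ↑-isUpSet (⋃ᶠ-contains ⊆ᴬ-refl)
                  (All.map (_∘ ⋃ᶠ↑-least up x∋pos) x∌neg)))
  , (neg , ≐-sym (isolated _ ∁⋃ᶠ↓-isUpSet (All.map (∁⋃ᶠ↓-greatest up x∌neg) x∋pos)
                  (All.map (λ b∈ b∉ → b∉ b∈) (⋃ᶠ-contains ⊆ᴬ-refl))))

finGen⇒isolated : IsFinGenUp x → IsCoFinGenDown x → IsIsolated x
finGen⇒isolated (as , x≐⋃↑) (bs , x≐∁⋃↓) =
  as , bs
  , All.map (≐⇒⊇ x≐⋃↑) (⋃ᶠ-contains ⊆ᴬ-refl)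
  , All.map (λ b∈ xb → ≐⇒⊆ x≐∁⋃↓ xb b∈) (⋃ᶠ-contains ⊆ᴬ-refl)
  , λ y up y∋as y∌bs → ≐-sym (≐-squeeze x≐⋃↑ x≐∁⋃↓ (⋃ᶠ↑-least up y∋as) (∁⋃ᶠ↓-greatest up y∌bs))

corollary5p2 : ExcludedMiddle 0ℓ → (x : Sub) → IsUpSet x →
    (IsIsolated x ⇔ IsFinUpDown x) × (IsFinUpDown x ⇔ InLatticeClosure x)
corollary5p2 em x up =
  mk⇔ (from ∘ isolated⇒finGen up) (uncurry finGen⇒isolated ∘ to) ,
  mk⇔ (uncurry (finGen⇒latticeClosure em) ∘ to) (from ∘ latticeClosure⇒finGen em)
  where open Equivalence isFinUpDown⇔
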